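{- Let $\mathcal{S}=\langle\mathcal{L},\vdash\rangle$ be a logic, with $\mathcal{L}$ a formula algebra over a denumerable set of variables $V$. Then its pure right variable inclusion companion $\mathcal{S}^{pr}=\langle\mathcal{L},\vdash^{pr}\rangle$ is NF-paraconsistent.
   Context: A logic is a pair $\langle\mathcal{L},\vdash\rangle$ with $\vdash\,\subseteq\mathcal{P}(\mathcal{L})\times\mathcal{L}$, and $C_\vdash(\Gamma)=\{\alpha:\Gamma\vdash\alpha\}$. $\mathcal{L}$ is the formula algebra over a denumerable set $V$ of variables in a finite signature. $\mathrm{var}(\alpha)$ is the set of variables in $\alpha$; $\mathrm{var}(\Gamma)=\bigcup_{\alpha\in\Gamma}\mathrm{var}(\alpha)$. $\Gamma\vdash^{pr}\alpha$ iff $\Gamma\vdash\alpha$ and $\mathrm{var}(\alpha)\subseteq\mathrm{var}(\Gamma)$. A logic is NF-paraconsistent if there exists $\alpha\in\mathcal{L}$ such that $C_\vdash(\{\alpha,\beta\})\neq\mathcal{L}$ for every $\beta\in\mathcal{L}$. -}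

module Defs where

open import Data.Nat using (ℕ)
open import Data.Fin using (Fin)
open import Data.Vec using (Vec)
open import Data.Vec.Membership.Propositional using () renaming (_∈_ to _∈ᵥ_)
open import Data.Product using (Σ; ∃; ∃-syntax; _×_)
open import Data.Sum using (_⊎_)
open import Relation.Binary.PropositionalEquality using (_≡_)
open import Relation.Nullary using (¬_)

record Signature : Set where
  field
    size  : ℕ
    arity : Fin size → ℕ
open Signature public

Var : Set
Var = ℕ

data Formula (S : Signature) : Set where
  var : Var → Formula S
  app : (f : Fin (size S)) → Vec (Formula S) (arity S f) → Formula S

data _∈var_ {S : Signature} (p : Var) : Formula S → Set where
  here  : p ∈var var p
  there : ∀ {f} {args : Vec (Formula S) (arity S f)} {β : Formula S} →
          β ∈ᵥ args → p ∈var β → p ∈var app f args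

FSet : Signature → Set₁
FSet S = Formula S → Set

_∈varSet_ : {S : Signature} → Var → FSet S → Set
_∈varSet_ {S} p Γ = ∃[ α ] (Γ α × p ∈var α)

-- A logic ⟨L, ⊢⟩ over the formula algebra L: an arbitrary relation ⊢ ⊆ P(L) × L.
Logic : Signature → Set₁
Logic S = FSet S → Formula S → Set

C : {S : Signature} → Logic S → FSet S → FSet S
C ⊢ Γ α = ⊢ Γ α

_ᵖʳ : {S : Signature} → Logic S → Logic S
(⊢ ᵖʳ) Γ α = ⊢ Γ α × (∀ p → p ∈var α → p ∈varSet Γ)

pair : {S : Signature} → Formula S → Formula S → FSet S
pair α β γ = (γ ≡ α) ⊎ (γ ≡ β)

-- NF-paraconsistent: ∃ α. ∀ β. C_⊢({α, β}) ≠ L,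
-- i.e. some formula lies outside C_⊢({α, β}).
NF-paraconsistent : {S : Signature} → Logic S → Set
NF-paraconsistent {S} ⊢ = ∃[ α ] ∀ (β : Formula S) → ∃[ γ ] ¬ C ⊢ (pair α β) γ

{-# OPTIONS --safe #-}
-- A companion derivation Γ ⊢ᵖʳ α needs every variable of α to occur in Γ. Since {α, β}
-- involves only finitely many variables, a variable beyond all of them is never a
-- consequence of {p₀, β}, whatever ⊢ is; so α = p₀ witnesses NF-paraconsistency.
module Submission where

open import Defs
open import Data.Nat using (ℕ; suc; _⊔_; _≤_)
open import Data.Nat.Properties using (≤-refl; ≤-trans; m≤m⊔n; m≤n⊔m; 1+n≰n)
open import Data.Vec using (Vec; []; _∷_)
open import Data.Vec.Membership.Propositional using (_∈_)
open import Data.Vec.Relation.Unary.Any using (here; there)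
open import Data.Product using (_,_)
open import Data.Sum using (inj₁; inj₂)
open import Relation.Binary.PropositionalEquality using (refl)
open import Relation.Nullary using (¬_)

module _ {S : Signature} where

  mutual
    varBound : Formula S → ℕ
    varBound (var p)      = p
    varBound (app f args) = varBoundⱽ args

    varBoundⱽ : ∀ {n} → Vec (Formula S) n → ℕ
    varBoundⱽ []       = 0
    varBoundⱽ (α ∷ αs) = varBound α ⊔ varBoundⱽ αs

  mutual
    ∈var⇒≤varBound : ∀ {p} (α : Formula S) → p ∈var α → p ≤ varBound α
    ∈var⇒≤varBound (var p)      here          = ≤-refl
    ∈var⇒≤varBound (app f args) (there α∈ p∈) = ∈varⱽ⇒≤varBoundⱽ args α∈ p∈

    ∈varⱽ⇒≤varBoundⱽ : ∀ {p n} (αs : Vec (Formula S) n) {α : Formula S} →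
                       α ∈ αs → p ∈var α → p ≤ varBoundⱽ αs
    ∈varⱽ⇒≤varBoundⱽ (α ∷ αs) (here refl) p∈ =
      ≤-trans (∈var⇒≤varBound α p∈) (m≤m⊔n (varBound α) (varBoundⱽ αs))
    ∈varⱽ⇒≤varBoundⱽ (α ∷ αs) (there α∈) p∈ =
      ≤-trans (∈varⱽ⇒≤varBoundⱽ αs α∈ p∈) (m≤n⊔m (varBound α) (varBoundⱽ αs))

  ∈varSet-pair⇒≤ : ∀ {p} (α β : Formula S) →
                   p ∈varSet pair α β → p ≤ varBound α ⊔ varBound β
  ∈varSet-pair⇒≤ α β (_ , inj₁ refl , p∈) =
    ≤-trans (∈var⇒≤varBound α p∈) (m≤m⊔n (varBound α) (varBound β))
  ∈varSet-pair⇒≤ α β (_ , inj₂ refl , p∈) =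
    ≤-trans (∈var⇒≤varBound β p∈) (m≤n⊔m (varBound α) (varBound β))

  ᵖʳ-⊬-fresh-var : ∀ (⊢ : Logic S) (Γ : FSet S) (n : ℕ) →
                   (∀ p → p ∈varSet Γ → p ≤ n) → ¬ (⊢ ᵖʳ) Γ (var (suc n))
  ᵖʳ-⊬-fresh-var ⊢ Γ n Γ≤n (_ , vars⊆) = 1+n≰n (Γ≤n (suc n) (vars⊆ (suc n) here))

theorem2p25 : (S : Signature) (⊢ : Logic S) → NF-paraconsistent (⊢ ᵖʳ)
theorem2p25 S ⊢ = var 0 , λ β →
  var (suc (varBound β)) ,
  ᵖʳ-⊬-fresh-var ⊢ (pair (var 0) β) (varBound β) (λ _ → ∈varSet-pair⇒≤ (var 0) β)
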